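{- Suppose an adversary presents a bipartite graph $G$ with no induced path on $9$ vertices to the algorithm described in the context. Let $x$ be a vertex with color index $i\ge2$, and let $y$ be a vertex of $C_{i-1}(x)$ with color index $j$ that lies on the side opposite to $x$ (in the component containing both) and is not adjacent to $x$. If $C^y_{i-1}[x]$ contains no induced path on $5$ vertices having $x$ as an endpoint, then $x$ has a neighbor in $C^y_{i-1}(x)$ that is universal to $C_{j-1}[y]$.
   Context: The algorithm uses three pairwise disjoint palettes of colors $\{a_n\}_{n\ge1}$, $\{b_n\}_{n\ge1}$, $\{c_n\}_{n\ge1}$. A vertex has color index $i$ if its color is $a_i$ or $b_i$. For a connected bipartite subgraph $C$, its sides are its two color classes; a color is mixed in $C$ if it is used on vertices of both sides of $C$. A vertex $u$ is universal to a subgraph $C$ if $u$ is adjacent to all vertices of one of the sides of $C$. When a vertex $v$ is presented, let $G_i[v]$ be the subgraph induced by $v$ together with all previously presented vertices colored with a color from $\{a_1,\dots,a_i,b_1,\dots,b_i,c_1,\dots,c_i\}$, let $C_i[v]$ be the connected component of $G_i[v]$ containing $v$, put $C_0[v]=\{v\}$, and let $C_i(v)$ be $C_i[v]$ with $v$ removed; for a vertex $w$ of $C_i(v)$, $C^w_i(v)$ is the connected component of $C_i(v)$ containing $w$, and $C^w_i[v]$ is the subgraph induced by $C^w_i(v)$ together with $v$. All these graphs refer to the moment the vertex in brackets/parentheses was presented. The algorithm colors the new vertex $v$ as follows: let $m=\max\{i\ge1: a_i \text{ is mixed in } C_i[v]\}+1$ (with $\max\emptyset=0$); let $I_1,I_2$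 be the sides of $C_m[v]$ with $v\in I_1$. If $a_m$ is used on a vertex of $I_2$, color $v$ with $b_m$; else if $c_m$ is used on a vertex of $I_2$, color $v$ with $a_m$; else if there exist $u\in I_1\cup I_2$ and $u'\in I_2$ such that $u$ has color index $j\ge m-\sqrt{2m}+2$ and $u'$ is universal to $C_{j-1}[u]$, color $v$ with $c_m$; otherwise color $v$ with $a_m$. -}

module Defs where

open import Data.Nat using (ℕ; zero; suc; _+_; _*_; _∸_; _^_; _≤_; _<_)
open import Data.Fin using (Fin; toℕ)
open import Data.Bool using (Bool; true; false; not)
open import Data.Product using (Σ; ∃; ∃-syntax; _×_; _,_)
open import Data.Sum using (_⊎_)
open import Data.Unit using (⊤)
open import Relation.Nullary using (¬_)
open import Relation.Binary.PropositionalEquality using (_≡_; _≢_)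
open import Function using (Injective; _⇔_)

-- Finite simple graphs whose vertices 0,1,…,n-1 are presented in this order.

record Graph : Set where
  field
    n      : ℕ
    adj    : Fin n → Fin n → Bool
    sym    : ∀ u v → adj u v ≡ adj v u
    irrefl : ∀ v → adj v v ≡ false

open Graph public

E : (g : Graph) → Fin (n g) → Fin (n g) → Set
E g u v = adj g u v ≡ true

-- "u was presented before v"
_≺_ : ∀ {k} → Fin k → Fin k → Set
u ≺ v = toℕ u < toℕ v

Bipartite : Graph → Set
Bipartite g = Σ (Fin (n g) → Bool) λ β → ∀ u v → E g u v → β u ≢ β v

InducedPath : (g : Graph) → (Fin (n g) → Set) → (k : ℕ) → (Fin k → Fin (n g)) → Set
InducedPath g S k p =
  (∀ a → S (p a)) × Injective _≡_ _≡_ p ×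
  (∀ a b → E g (p a) (p b) ⇔ (toℕ b ≡ suc (toℕ a) ⊎ toℕ a ≡ suc (toℕ b)))

InducedPathFree : Graph → ℕ → Set
InducedPathFree g k = ¬ (Σ (Fin k → Fin (n g)) λ p → InducedPath g (λ _ → ⊤) k p)

-- In a bipartite graph, the component of u in
-- the subgraph induced by S is {w | ∃ p. Walk g S u w p}, the side of u is
-- {w | Walk g S u w false} and the other side is {w | Walk g S u w true}.

data Walk (g : Graph) (S : Fin (n g) → Set) (u : Fin (n g)) : Fin (n g) → Bool → Set where
  start : S u → Walk g S u u false
  step  : ∀ {w w' p} → Walk g S u w p → S w' → E g w w' → Walk g S u w' (not p)

-- Colors: three disjoint palettes a_k, b_k, c_k (k ≥ 1).

data Color : Set where
  a b c : ℕ → Color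

lvl : Color → ℕ
lvl (a k) = k
lvl (b k) = k
lvl (c k) = k

Coloring : Graph → Set
Coloring g = Fin (n g) → Color

HasIndex : (g : Graph) → Coloring g → Fin (n g) → ℕ → Set
HasIndex g col w k = (col w ≡ a k) ⊎ (col w ≡ b k)

-- vertex set of G_k[v]: v together with the earlier vertices colored from
-- {a_1..a_k, b_1..b_k, c_1..c_k}.  (For k = 0 this is {v}, i.e. C_0[v] = {v}.)
InG : (g : Graph) → Coloring g → ℕ → Fin (n g) → Fin (n g) → Set
InG g col k v w = (w ≡ v) ⊎ (w ≺ v × 1 ≤ lvl (col w) × lvl (col w) ≤ k)

InGo : (g : Graph) → Coloring g → ℕ → Fin (n g) → Fin (n g) → Set
InGo g col k v w = w ≺ v × 1 ≤ lvl (col w) × lvl (col w) ≤ k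

SameSide : (g : Graph) → Coloring g → ℕ → Fin (n g) → Fin (n g) → Set
SameSide g col k v w = Walk g (InG g col k v) v w false

OppSide : (g : Graph) → Coloring g → ℕ → Fin (n g) → Fin (n g) → Set
OppSide g col k v w = Walk g (InG g col k v) v w true

InC : (g : Graph) → Coloring g → ℕ → Fin (n g) → Fin (n g) → Set
InC g col k v w = Σ Bool λ p → Walk g (InG g col k v) v w p

-- the color a_k is mixed in C_k[v] (only already colored vertices, i.e.
-- those presented before v, carry a color at that moment)
Mixed : (g : Graph) → Coloring g → ℕ → Fin (n g) → Set
Mixed g col k v =
  (∃[ w ] (w ≺ v × SameSide g col k v w × col w ≡ a k)) ×
  (∃[ w ] (w ≺ v × OppSide g col k v w × col w ≡ a k))

Universal : (g : Graph) → Coloring g → Fin (n g) → ℕ → Fin (n g) → Set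
Universal g col u' k u =
  (∀ z → Walk g (InG g col k u) u z false → E g u' z) ⊎
  (∀ z → Walk g (InG g col k u) u z true → E g u' z)

-- m = max{ i ≥ 1 : a_i mixed in C_i[v] } + 1   (max ∅ = 0)
IsM : (g : Graph) → Coloring g → Fin (n g) → ℕ → Set
IsM g col v m =
  ((m ≡ 1) ⊎ (2 ≤ m × Mixed g col (m ∸ 1) v)) ×
  (∀ i → m ≤ i → ¬ Mixed g col i v)

-- j ≥ m - √(2m) + 2, stated over ℕ:  (m + 2 - j)₊² ≤ 2m
IndexLarge : ℕ → ℕ → Set
IndexLarge m j = (m + 2 ∸ j) ^ 2 ≤ 2 * m

CondA : (g : Graph) → Coloring g → Fin (n g) → ℕ → Set
CondA g col v m = ∃[ w ] (w ≺ v × OppSide g col m v w × col w ≡ a m)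

CondC : (g : Graph) → Coloring g → Fin (n g) → ℕ → Set
CondC g col v m = ∃[ w ] (w ≺ v × OppSide g col m v w × col w ≡ c m)

CondU : (g : Graph) → Coloring g → Fin (n g) → ℕ → Set
CondU g col v m =
  ∃[ u ] ∃[ u' ] ∃[ j ]
    (u ≺ v × InC g col m v u × HasIndex g col u j × IndexLarge m j ×
     u' ≺ v × OppSide g col m v u' × Universal g col u' (j ∸ 1) u)

AlgStep : (g : Graph) → Coloring g → Fin (n g) → Set
AlgStep g col v = ∃[ m ] (IsM g col v m ×
  ( (CondA g col v m × col v ≡ b m)
  ⊎ (¬ CondA g col v m × CondC g col v m × col v ≡ a m)
  ⊎ (¬ CondA g col v m × ¬ CondC g col v m × CondU g col v m × col v ≡ c m)
  ⊎ (¬ CondA g col v m × ¬ CondC g col v m × ¬ CondU g col v m × col v ≡ a m)))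

FollowsAlg : (g : Graph) → Coloring g → Set
FollowsAlg g col = ∀ v → AlgStep g col v

module Submission where

-- Without an induced P5 from x, every path x v w s z in {x} ∪ C with
-- x ≁ s has the chord v z ("chord").  (1) Following a walk inside C from y to
-- a neighbour of x, a parity invariant built on the chord property yields a
-- route x u w y through C ("route").  (2) Following walks inside C_{j-1}[y]
-- from y, the chord property shows that u sees the whole side of C_{j-1}[y]
-- opposite to y ("universalNeighbour").  The only obstacle is a vertex of
-- C_{j-1}(y) adjacent to x: it would be adjacent to all neighbours of y and so
-- connect C_{j-1}(y).  The algorithm forbids this: y got index j ≥ 2 because
-- a_{j-1} was mixed in C_{j-1}[y], yet two a_L vertices joined through levels
-- 1..L always lie on one side ("aNeverMixed", by induction on time).

open import Defs
open import Data.Nat using (ℕ; zero; suc; _≤_; _<_; _∸_)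
open import Data.Nat.Properties using (≤∧≢⇒<; ≤-pred; m∸n≤m; <-irrefl; <-trans; ≤-trans)
import Data.Nat.Properties as ℕ
open import Data.Fin using (Fin; zero; suc; toℕ)
open import Data.Fin.Properties using (toℕ-injective; toℕ<n; all?)
import Data.Fin.Properties as Fin
open import Data.Bool using (Bool; true; false; not; _xor_)
open import Data.Bool.Properties using (¬-not; not-¬; not-distribˡ-xor)
import Data.Bool.Properties as Bool
open import Data.Product using (Σ; ∃-syntax; _×_; _,_; proj₁; proj₂)
open import Data.Sum using (_⊎_; inj₁; inj₂)
open import Data.Empty using (⊥; ⊥-elim)
open import Relation.Nullary using (¬_; Dec; yes; no; does; contradiction)
open import Relation.Nullary.Decidable using (_⊎-dec_; _×-dec_; _→-dec_; toWitness)
open import Relation.Binary.PropositionalEquality using (_≡_; _≢_; refl; cong; subst; trans)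
  renaming (sym to ≡-sym)
open import Function using (_∘_; _⇔_; mk⇔; Equivalence)

notSelf : ∀ {b : Bool} → b ≡ not b → ⊥
notSelf = not-¬ refl

module Walks {g : Graph} where

  Reach : (Fin (n g) → Set) → Fin (n g) → Fin (n g) → Set
  Reach S u w = Σ Bool (Walk g S u w)

  adjacent? : ∀ u v → Dec (E g u v)
  adjacent? u v = adj g u v Bool.≟ true

  esym : ∀ {u v} → E g u v → E g v u
  esym {u} {v} e = trans (sym g v u) e

  wmap : ∀ {S S' : Fin (n g) → Set} → (∀ w → S w → S' w) →
         ∀ {u w p} → Walk g S u w p → Walk g S' u w p
  wmap f (start s)    = start (f _ s)
  wmap f (step W s e) = step (wmap f W) (f _ s) e

  wstart : ∀ {S u w p} → Walk g S u w p → S u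
  wstart (start s)    = s
  wstart (step W _ _) = wstart W

  wend : ∀ {S u w p} → Walk g S u w p → S w
  wend (start s)    = s
  wend (step _ s _) = s

  prepend : ∀ {S u v w p} → E g u v → S u → Walk g S v w p → Walk g S u w (not p)
  prepend e su (start sv)    = step (start su) sv e
  prepend e su (step W s e') = step (prepend e su W) s e'

  reverse : ∀ {S u w p} → Walk g S u w p → Walk g S w u p
  reverse (start s)    = start s
  reverse (step W s e) = prepend (esym e) s (reverse W)

  append : ∀ {S u v w p q} → Walk g S u v p → Walk g S v w q → Reach S u w
  append W (start _) = _ , W
  append W (step V s e) with append W V
  ... | _ , X = _ , step X s e

  lastDeparture : ∀ {S x w p} → Walk g (λ z → z ≡ x ⊎ S z) x w p →
                  w ≡ x ⊎ Σ (Fin (n g)) λ u → E g x u × Reach S u w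
  lastDeparture (start _)            = inj₁ refl
  lastDeparture (step _ (inj₁ eq) _) = inj₁ eq
  lastDeparture (step W (inj₂ s) e) with lastDeparture W
  ... | inj₁ refl             = inj₂ (_ , e , _ , start s)
  ... | inj₂ (u , xu , _ , U) = inj₂ (u , xu , _ , step U s e)

module Bipartition {g : Graph} (β : Fin (n g) → Bool) (bip : ∀ u v → E g u v → β u ≢ β v) where
  open Walks {g}

  opposite : ∀ {u v} → E g u v → β v ≡ not (β u)
  opposite e = ¬-not (bip _ _ (esym e))

  side : ∀ {S u w p} → Walk g S u w p → β w ≡ p xor β u
  side (start _) = refl
  side (step {p = p} W _ e) = trans (opposite e) (trans (cong not (side W)) (not-distribˡ-xor p _))

  twoSteps : ∀ {u v w} → E g u v → E g v w → β u ≡ β w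
  twoSteps e e' = Bool.not-injective (trans (≡-sym (opposite e)) (opposite (esym e')))

  sameSideNonAdjacent : ∀ {u v} → β u ≡ β v → adj g u v ≡ false
  sameSideNonAdjacent {u} {v} eq with adjacent? u v
  ... | yes e = contradiction eq (bip u v e)
  ... | no ¬e = ¬-not ¬e

  oddWalkMoves : ∀ {S u w} → Walk g S u w true → w ≢ u
  oddWalkMoves W refl = notSelf (side W)

Consecutive : ∀ {k} → Fin k → Fin k → Set
Consecutive p q = toℕ q ≡ suc (toℕ p) ⊎ toℕ p ≡ suc (toℕ q)

consecutive? : ∀ {k} (p q : Fin k) → Dec (Consecutive p q)
consecutive? p q = (toℕ q ℕ.≟ suc (toℕ p)) ⊎-dec (toℕ p ℕ.≟ suc (toℕ q))

SameNeighbours : ∀ {k} → Fin k → Fin k → Set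
SameNeighbours p q = ∀ m → (Consecutive p m → Consecutive q m) × (Consecutive q m → Consecutive p m)

-- on a path with five vertices, a position is determined by its neighbours
-- (a finite check, decided by computation); this makes the path injective
positionByNeighbours : ∀ (p q : Fin 5) → SameNeighbours p q → p ≡ q
positionByNeighbours = toWitness {a? = decision} _
  where
    decision : Dec (∀ (p q : Fin 5) → SameNeighbours p q → p ≡ q)
    decision = all? λ p → all? λ q →
      (all? λ m → (consecutive? p m →-dec consecutive? q m) ×-dec (consecutive? q m →-dec consecutive? p m))
      →-dec (p Fin.≟ q)

-- In a bipartite graph five vertices p₀ ~ p₁ ~ p₂ ~ p₃ ~ p₄ with p₀ ≁ p₃ and
-- p₁ ≁ p₄ form an induced path: the remaining pairs lie on one side.
module FivePath {g : Graph} (β : Fin (n g) → Bool) (bip : ∀ u v → E g u v → β u ≢ β v)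
  {p₀ p₁ p₂ p₃ p₄ : Fin (n g)}
  (e₀₁ : E g p₀ p₁) (e₁₂ : E g p₁ p₂) (e₂₃ : E g p₂ p₃) (e₃₄ : E g p₃ p₄)
  (n₀₃ : adj g p₀ p₃ ≡ false) (n₁₄ : adj g p₁ p₄ ≡ false) where
  open Walks {g}
  open Bipartition {g} β bip

  path : Fin 5 → Fin (n g)
  path zero                         = p₀
  path (suc zero)                   = p₁
  path (suc (suc zero))             = p₂
  path (suc (suc (suc zero)))       = p₃
  path (suc (suc (suc (suc zero)))) = p₄

  adjMatrix : ∀ k l → adj g (path k) (path l) ≡ does (consecutive? k l)
  adjMatrix zero zero = irrefl g p₀
  adjMatrix zero (suc zero) = e₀₁
  adjMatrix zero (suc (suc zero)) = sameSideNonAdjacent (twoSteps e₀₁ e₁₂)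
  adjMatrix zero (suc (suc (suc zero))) = n₀₃
  adjMatrix zero (suc (suc (suc (suc zero)))) =
    sameSideNonAdjacent (trans (twoSteps e₀₁ e₁₂) (twoSteps e₂₃ e₃₄))
  adjMatrix (suc zero) (suc zero) = irrefl g p₁
  adjMatrix (suc zero) (suc (suc zero)) = e₁₂
  adjMatrix (suc zero) (suc (suc (suc zero))) = sameSideNonAdjacent (twoSteps e₁₂ e₂₃)
  adjMatrix (suc zero) (suc (suc (suc (suc zero)))) = n₁₄
  adjMatrix (suc (suc zero)) (suc (suc zero)) = irrefl g p₂
  adjMatrix (suc (suc zero)) (suc (suc (suc zero))) = e₂₃
  adjMatrix (suc (suc zero)) (suc (suc (suc (suc zero)))) = sameSideNonAdjacent (twoSteps e₂₃ e₃₄)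
  adjMatrix (suc (suc (suc zero))) (suc (suc (suc zero))) = irrefl g p₃
  adjMatrix (suc (suc (suc zero))) (suc (suc (suc (suc zero)))) = e₃₄
  adjMatrix (suc (suc (suc (suc zero)))) (suc (suc (suc (suc zero)))) = irrefl g p₄
  adjMatrix k@(suc zero) l@zero = trans (sym g _ _) (adjMatrix l k)
  adjMatrix k@(suc (suc zero)) l@zero = trans (sym g _ _) (adjMatrix l k)
  adjMatrix k@(suc (suc zero)) l@(suc zero) = trans (sym g _ _) (adjMatrix l k)
  adjMatrix k@(suc (suc (suc zero))) l@zero = trans (sym g _ _) (adjMatrix l k)
  adjMatrix k@(suc (suc (suc zero))) l@(suc zero) = trans (sym g _ _) (adjMatrix l k)
  adjMatrix k@(suc (suc (suc zero))) l@(suc (suc zero)) = trans (sym g _ _) (adjMatrix l k)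
  adjMatrix k@(suc (suc (suc (suc zero)))) l@zero = trans (sym g _ _) (adjMatrix l k)
  adjMatrix k@(suc (suc (suc (suc zero)))) l@(suc zero) = trans (sym g _ _) (adjMatrix l k)
  adjMatrix k@(suc (suc (suc (suc zero)))) l@(suc (suc zero)) = trans (sym g _ _) (adjMatrix l k)
  adjMatrix k@(suc (suc (suc (suc zero)))) l@(suc (suc (suc zero))) = trans (sym g _ _) (adjMatrix l k)

  adjacency : ∀ k l → E g (path k) (path l) ⇔ Consecutive k l
  adjacency k l = reflected (consecutive? k l) (adjMatrix k l)
    where
      reflected : ∀ {A : Set} (d : Dec A) {b} → b ≡ does d → (b ≡ true) ⇔ A
      reflected (yes x) refl = mk⇔ (λ _ → x) (λ _ → refl)
      reflected (no ¬x) refl = mk⇔ (λ ()) (λ x → contradiction x ¬x)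

  injective : ∀ {k l} → path k ≡ path l → k ≡ l
  injective {k} {l} eq = positionByNeighbours k l λ m →
    (λ cons → Equivalence.to (adjacency l m) (subst (λ v → E g v (path m)) eq (Equivalence.from (adjacency k m) cons))) ,
    (λ cons → Equivalence.to (adjacency k m) (subst (λ v → E g v (path m)) (≡-sym eq) (Equivalence.from (adjacency l m) cons)))

  induced : (S : Fin (n g) → Set) → (∀ k → S (path k)) → InducedPath g S 5 path
  induced S inS = inS , injective , adjacency

indexLevel : ∀ {g col w j} → HasIndex g col w j → lvl (col w) ≡ j
indexLevel (inj₁ eq) = cong lvl eq
indexLevel (inj₂ eq) = cong lvl eq

Level : (g : Graph) → Coloring g → ℕ → Fin (n g) → Set
Level g col L w = 1 ≤ lvl (col w) × lvl (col w) ≤ L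

module Algorithm (g : Graph) (β : Fin (n g) → Bool) (bip : ∀ u v → E g u v → β u ≢ β v)
  (col : Coloring g) (follows : FollowsAlg g col) where
  open Walks {g}
  open Bipartition {g} β bip

  stepLevel : ∀ {v} (st : AlgStep g col v) → lvl (col v) ≡ proj₁ st
  stepLevel (_ , _ , inj₁ (_ , eq))                         = cong lvl eq
  stepLevel (_ , _ , inj₂ (inj₁ (_ , _ , eq)))              = cong lvl eq
  stepLevel (_ , _ , inj₂ (inj₂ (inj₁ (_ , _ , _ , eq))))   = cong lvl eq
  stepLevel (_ , _ , inj₂ (inj₂ (inj₂ (_ , _ , _ , eq))))   = cong lvl eq

  aAvoidsCondA : ∀ {v L} → col v ≡ a L → ¬ CondA g col v L
  aAvoidsCondA {v} cv with follows v
  ... | _ , _ , inj₁ (_ , cb)                        = contradiction (trans (≡-sym cv) cb) λ ()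
  ... | _ , _ , inj₂ (inj₁ (¬A , _ , ca))            = subst (¬_ ∘ CondA g col v) (cong lvl (trans (≡-sym ca) cv)) ¬A
  ... | _ , _ , inj₂ (inj₂ (inj₁ (_ , _ , _ , cc)))  = contradiction (trans (≡-sym cv) cc) λ ()
  ... | _ , _ , inj₂ (inj₂ (inj₂ (¬A , _ , _ , ca))) = subst (¬_ ∘ CondA g col v) (cong lvl (trans (≡-sym ca) cv)) ¬A

  mixedBelow : ∀ {v} → 1 ≤ lvl (col v) ∸ 1 → Mixed g col (lvl (col v) ∸ 1) v
  mixedBelow {v} pos with follows v | stepLevel (follows v)
  ... | _ , (inj₁ refl , _) , _        | lv = contradiction (subst (λ k → 1 ≤ k ∸ 1) lv pos) λ ()
  ... | _ , (inj₂ (_ , mixed) , _) , _ | lv = subst (λ k → Mixed g col (k ∸ 1) v) (≡-sym lv) mixed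

  module AfterStep {v L} (level≤L : lvl (col v) ≤ L) where
    notMixed : ¬ Mixed g col L v
    notMixed = proj₂ (proj₁ (proj₂ (follows v))) L (subst (_≤ L) (stepLevel (follows v)) level≤L)

    oddEndPrecedes : ∀ {w} → Walk g (InG g col L v) v w true → w ≺ v
    oddEndPrecedes W with wend W
    ... | inj₁ eq      = contradiction eq (oddWalkMoves W)
    ... | inj₂ (w≺v , _) = w≺v

    -- a_L cannot occur on both sides of C_L[v]: if v itself is coloured a_L this
    -- is the failure of CondA, otherwise it is the absence of mixing
    evenOdd : ∀ {a₁ a₂} → Walk g (InG g col L v) v a₁ false → Walk g (InG g col L v) v a₂ true →
              col a₁ ≡ a L → col a₂ ≡ a L → ⊥
    evenOdd W₁ W₂ c₁ c₂ with wend W₁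
    ... | inj₁ refl        = aAvoidsCondA c₁ (_ , oddEndPrecedes W₂ , W₂ , c₂)
    ... | inj₂ (a₁≺v , _)  = notMixed ((_ , a₁≺v , W₁ , c₁) , (_ , oddEndPrecedes W₂ , W₂ , c₂))

    sameSide : ∀ {a₁ a₂ p₁ p₂} → Walk g (InG g col L v) v a₁ p₁ → Walk g (InG g col L v) v a₂ p₂ →
               col a₁ ≡ a L → col a₂ ≡ a L → β a₁ ≡ β a₂
    sameSide {p₁ = false} {false} W₁ W₂ _ _   = trans (side W₁) (≡-sym (side W₂))
    sameSide {p₁ = true}  {true}  W₁ W₂ _ _   = trans (side W₁) (≡-sym (side W₂))
    sameSide {p₁ = false} {true}  W₁ W₂ c₁ c₂ = ⊥-elim (evenOdd W₁ W₂ c₁ c₂)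
    sameSide {p₁ = true}  {false} W₁ W₂ c₁ c₂ = ⊥-elim (evenOdd W₂ W₁ c₂ c₁)

  Early : ℕ → ℕ → Fin (n g) → Set
  Early L T w = toℕ w < T × Level g col L w

  -- Induction on time T: a walk through levels 1..L among the first T + 1
  -- vertices either avoids the vertex v presented at time T, or joins both of
  -- its ends to v inside C_L[v], where AfterStep applies.
  module UpToTime (L : ℕ) where
    newestOrEarlier : ∀ T w → Early L (suc T) w → toℕ w ≡ T ⊎ Early L T w
    newestOrEarlier T w (lt , lv) with toℕ w ℕ.≟ T
    ... | yes eq = inj₁ eq
    ... | no ne  = inj₂ (≤∧≢⇒< (≤-pred lt) ne , lv)

    inG : ∀ {v T} → toℕ v ≡ T → ∀ w → Early L (suc T) w → InG g col L v w
    inG {v} tv w e with w Fin.≟ v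
    ... | yes eq = inj₁ eq
    ... | no ne with newestOrEarlier _ w e
    ...   | inj₁ eq       = contradiction (toℕ-injective (trans eq (≡-sym tv))) ne
    ...   | inj₂ (lt , lv) = inj₂ (subst (toℕ w <_) (≡-sym tv) lt , lv)

    throughNewest : ∀ T {a₁ a₂ r} → Walk g (Early L (suc T)) a₁ a₂ r →
      Reach (Early L T) a₁ a₂ ⊎
      Σ (Fin (n g)) λ v → toℕ v ≡ T × Reach (Early L (suc T)) v a₁ × Reach (Early L (suc T)) v a₂
    throughNewest T {a₁} (start s) with newestOrEarlier T a₁ s
    ... | inj₁ eq = inj₂ (a₁ , eq , (_ , start s) , (_ , start s))
    ... | inj₂ s' = inj₁ (_ , start s')
    throughNewest T {a₂ = a₂} (step W s e) with throughNewest T W | newestOrEarlier T a₂ s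
    ... | inj₁ _ | inj₁ eq                  = inj₂ (a₂ , eq , (_ , reverse (step W s e)) , (_ , start s))
    ... | inj₁ (_ , W') | inj₂ s'           = inj₁ (_ , step W' s' e)
    ... | inj₂ (v , tv , A , (_ , B)) | _   = inj₂ (v , tv , A , (_ , step B s e))

    unmixedUpTo : ∀ T {a₁ a₂ r} → Walk g (Early L T) a₁ a₂ r → col a₁ ≡ a L → col a₂ ≡ a L → β a₁ ≡ β a₂
    unmixedUpTo zero W _ _ with wstart W
    ... | () , _
    unmixedUpTo (suc T) W c₁ c₂ with throughNewest T W
    ... | inj₁ (_ , W') = unmixedUpTo T W' c₁ c₂
    ... | inj₂ (v , tv , (_ , A) , (_ , B)) =
      AfterStep.sameSide (proj₂ (proj₂ (wstart A))) (wmap (inG tv) A) (wmap (inG tv) B) c₁ c₂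

  aNeverMixed : ∀ L {a₁ a₂ r} → Walk g (Level g col L) a₁ a₂ r → col a₁ ≡ a L → col a₂ ≡ a L → β a₁ ≡ β a₂
  aNeverMixed L W = UpToTime.unmixedUpTo L (n g) (wmap (λ w lv → toℕ<n w , lv) W)

  hubReaches : ∀ {y L t} → InGo g col L y t → (∀ r → E g y r → InGo g col L y r → E g t r) →
               ∀ {z p} → Walk g (InG g col L y) y z p → z ≡ y ⊎ Reach (InGo g col L y) t z
  hubReaches t∈ hub (start _)            = inj₁ refl
  hubReaches t∈ hub (step _ (inj₁ eq) _) = inj₁ eq
  hubReaches t∈ hub (step W (inj₂ s) e) with hubReaches t∈ hub W
  ... | inj₁ refl    = inj₂ (_ , step (start t∈) s (hub _ e s))
  ... | inj₂ (_ , U) = inj₂ (_ , step U s e)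

  -- if a_L is mixed in C_L[y], there is no such hub: it would join the two
  -- a_L witnesses on opposite sides inside C_L(y)
  noHub : ∀ {y L t} → Mixed g col L y → InGo g col L y t →
          ¬ (∀ r → E g y r → InGo g col L y r → E g t r)
  noHub {y} {L} ((w₁ , w₁≺y , W₁ , c₁) , (w₂ , w₂≺y , W₂ , c₂)) t∈ hub
    with hubReaches t∈ hub W₁ | hubReaches t∈ hub W₂
  ... | inj₁ eq | _ = <-irrefl (cong toℕ eq) w₁≺y
  ... | inj₂ _ | inj₁ eq = <-irrefl (cong toℕ eq) w₂≺y
  ... | inj₂ (_ , U₁) | inj₂ (_ , U₂) =
    notSelf (trans (≡-sym (side W₁)) (trans (aNeverMixed L (wmap (λ _ → proj₂) (proj₂ joined)) c₁ c₂) (side W₂)))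
    where
      joined : Reach (InGo g col L y) w₁ w₂
      joined = append (reverse U₁) U₂

module Claim (g : Graph) (β : Fin (n g) → Bool) (bip : ∀ u v → E g u v → β u ≢ β v)
  (col : Coloring g) (follows : FollowsAlg g col)
  (x y : Fin (n g)) (K : ℕ) (y≺x : y ≺ x) (opp : OppSide g col K x y) (x≁y : ¬ E g x y)
  (noP5 : ¬ (Σ (Fin 5 → Fin (n g)) λ p →
               InducedPath g (λ w → (w ≡ x) ⊎ (Σ Bool λ q → Walk g (InGo g col K x) y w q)) 5 p
               × p zero ≡ x)) where
  open Walks {g}
  open Bipartition {g} β bip
  open Algorithm g β bip col follows

  Comp : Fin (n g) → Set
  Comp = Reach (InGo g col K x) y

  y∈Gx : InGo g col K x y
  y∈Gx with wend opp
  ... | inj₁ y≡x = contradiction y≺x (<-irrefl (cong toℕ y≡x))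
  ... | inj₂ s   = s

  y∈C : Comp y
  y∈C = false , start y∈Gx

  -- a path x v w s z in {x} ∪ C^y_K(x) with x ≁ s has the chord v z,
  -- for otherwise it is an induced P5 starting at x
  chord : ∀ {v w s z} → E g x v → E g v w → E g w s → E g s z → ¬ E g x s →
          Comp v → Comp w → Comp s → Comp z → E g v z
  chord {v} {w} {s} {z} xv vw ws sz x≁s v∈ w∈ s∈ z∈ with adjacent? v z
  ... | yes vz  = vz
  ... | no v≁z = contradiction (path , induced (λ w → w ≡ x ⊎ Comp w) inside , refl) noP5
    where
      open FivePath {g} β bip xv vw ws sz (¬-not x≁s) (¬-not v≁z)
      inside : ∀ k → path k ≡ x ⊎ Comp (path k)
      inside zero                         = inj₁ refl
      inside (suc zero)                   = inj₂ v∈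
      inside (suc (suc zero))             = inj₂ w∈
      inside (suc (suc (suc zero)))       = inj₂ s∈
      inside (suc (suc (suc (suc zero)))) = inj₂ z∈

  Route : Set
  Route = Σ (Fin (n g)) λ u → Σ (Fin (n g)) λ w → E g x u × E g u w × E g w y × Comp u × Comp w

  Anchor : Fin (n g) → Set
  Anchor z = ∀ v → E g x v → Comp v → E g v z → Route

  RouteInvariant : Bool → Fin (n g) → Set
  RouteInvariant true  z = Anchor z
  RouteInvariant false z = Route ⊎ (¬ E g x z × (∀ z' → E g z z' → Comp z' → Anchor z'))

  routeInvariant : ∀ {z p} → Walk g (InGo g col K x) y z p → RouteInvariant p z
  routeInvariant (start _) =
    inj₂ (x≁y , λ z' yz' z'∈ v xv v∈ vz' → v , z' , xv , vz' , esym yz' , v∈ , z'∈)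
  routeInvariant (step {p = false} W s e) with routeInvariant W
  ... | inj₁ r             = λ _ _ _ _ → r
  ... | inj₂ (_ , anchors) = anchors _ e (_ , step W s e)
  routeInvariant (step {w' = z'} {p = true} W s e) with adjacent? x z'
  ... | yes xz'  = inj₁ (routeInvariant W z' xz' (_ , step W s e) (esym e))
  ... | no x≁z' = inj₂ (x≁z' , λ z'' z'z'' z''∈ v xv v∈ vz'' →
        routeInvariant W v xv v∈ (chord xv vz'' (esym z'z'') (esym e) x≁z' v∈ z''∈ (_ , step W s e) (_ , W)))

  -- the walk from x to y leaves x for the last time at a neighbour u₀; the
  -- remaining walk from u₀ to y is even, and u₀ ~ x forces a route
  route : Route
  route with lastDeparture {S = InGo g col K x} opp
  ... | inj₁ y≡x                = contradiction y≺x (<-irrefl (cong toℕ y≡x))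
  ... | inj₂ (u₀ , xu₀ , p , U) = fromWalk p (reverse U)
    where
      fromWalk : ∀ p → Walk g (InGo g col K x) y u₀ p → Route
      fromWalk false R with routeInvariant R
      ... | inj₁ r          = r
      ... | inj₂ (x≁u₀ , _) = contradiction xu₀ x≁u₀
      fromWalk true R = ⊥-elim (notSelf (trans (side opp) (trans (≡-sym (opposite xu₀)) (side R))))

  J : ℕ
  J = lvl (col y) ∸ 1

  inGx : ∀ w → InG g col J y w → InGo g col K x w
  inGx w (inj₁ refl)              = y∈Gx
  inGx w (inj₂ (w≺y , pos , ≤J)) =
    <-trans w≺y y≺x , pos , ≤-trans ≤J (≤-trans (m∸n≤m _ 1) (proj₂ (proj₂ y∈Gx)))

  inC : ∀ {z p} → Walk g (InG g col J y) y z p → Comp z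
  inC W = _ , wmap inGx W

  noTwin : ∀ {t} → InG g col J y t → E g x t → ¬ (∀ r → E g y r → Comp r → E g t r)
  noTwin (inj₁ refl) xy _ = x≁y xy
  noTwin (inj₂ t∈) _ hub =
    noHub (mixedBelow (≤-trans (proj₁ (proj₂ t∈)) (proj₂ (proj₂ t∈)))) t∈
          (λ r yr r∈ → hub r yr (inC (step (start (inj₁ refl)) (inj₂ r∈) yr)))

  module FromRoute {u w} (xu : E g x u) (uw : E g u w) (wy : E g w y) (u∈ : Comp u) (w∈ : Comp w) where
    Link : Fin (n g) → Set
    Link z = ∀ v → E g x v → Comp v → E g v z → ∀ r → E g y r → Comp r → E g v r

    Invariant : Bool → Fin (n g) → Set
    Invariant true  z = E g u z × Link z
    Invariant false z = ¬ E g x z × (∀ z' → E g z z' → Comp z' → E g u z' × Link z')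

    invariant : ∀ {z p} → Walk g (InG g col J y) y z p → Invariant p z
    invariant (start _) = x≁y , λ z' yz' z'∈ →
      chord xu uw wy yz' x≁y u∈ w∈ y∈C z'∈ ,
      λ v xv v∈ vz' r yr r∈ → chord xv vz' (esym yz') yr x≁y v∈ z'∈ y∈C r∈
    invariant (step {p = false} W s e) = proj₂ (invariant W) _ e (inC (step W s e))
    invariant (step {w' = z'} {p = true} W s e) with adjacent? x z'
    ... | yes xz'  = ⊥-elim (noTwin s xz' (proj₂ (invariant W) z' xz' (inC (step W s e)) (esym e)))
    ... | no x≁z' = x≁z' , λ z'' z'z'' z''∈ →
      chord xu (proj₁ (invariant W)) e z'z'' x≁z' u∈ (inC W) (inC (step W s e)) z''∈ ,
      λ v xv v∈ vz'' r yr r∈ → proj₂ (invariant W) v xv v∈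
        (chord xv vz'' (esym z'z'') (esym e) x≁z' v∈ z''∈ (inC (step W s e)) (inC W)) r yr r∈

  universalNeighbour : Route → ∃[ u ] (E g x u × Comp u × Universal g col u J y)
  universalNeighbour (u , w , xu , uw , wy , u∈ , w∈) =
    u , xu , u∈ , inj₂ (λ z W → proj₁ (invariant W))
    where open FromRoute xu uw wy u∈ w∈

-- The theorem: identify j with the level of y's colour, find the route x u w y,
-- and take u.  P9-freeness and the index of x play no role in this step.
claim6 : (g : Graph) → Bipartite g → InducedPathFree g 9 →
         (col : Coloring g) → FollowsAlg g col →
         (x : Fin (n g)) (i : ℕ) → HasIndex g col x i → 2 ≤ i →
         (y : Fin (n g)) (j : ℕ) →
         y ≺ x → OppSide g col (i ∸ 1) x y → HasIndex g col y j → ¬ E g x y →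
         ¬ (Σ (Fin 5 → Fin (n g)) λ p →
              InducedPath g (λ w → (w ≡ x) ⊎ (Σ Bool λ q → Walk g (InGo g col (i ∸ 1) x) y w q)) 5 p
              × p zero ≡ x) →
         ∃[ u ] (E g x u × (Σ Bool λ q → Walk g (InGo g col (i ∸ 1) x) y u q) ×
                 Universal g col u (j ∸ 1) y)
claim6 g (β , bip) _ col follows x i _ _ y j y≺x opp hy x≁y noP5 with indexLevel {g} {col} hy
... | refl = universalNeighbour route
  where open Claim g β bip col follows x y (i ∸ 1) y≺x opp x≁y noP5
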